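{- Let $n\ge 4$, let $r>1$ be real, and let $T$ be a triangulation of the convex $n$-gon with vertices labelled $0,\ldots,n-1$ clockwise. Let $AC$ be a non-boundary edge of $T$ whose quadrilateral is $ABCD$ with $A<B<C<D$, and let $T'$ be obtained from $T$ by flipping $AC$ (replacing it by $BD$). If exactly two of $\sigma_{AC}$, $\sigma_{BD}$, $\sigma_{BC}$ are equal, then $c(T')\ne c(T)$.
   Context: Triangulations contain the boundary edges $01,12,\ldots,(n-1)0$. For a non-boundary edge $e$ of a triangulation $T$, its quadrilateral $Q_T(e)=ABCD$ (vertices listed with $A<B<C<D$) is the union of the two triangles of $T$ containing $e$; flipping $e$ replaces $e$ by the other diagonal. $Q_T(e)$ (and $e$) is called type-1 if $e=AC$ and type-2 otherwise. The scale of an edge $e=UV$ is $\sigma_e=\lceil\log_r|U-V|\rceil$. For $k\in\{1,2\}$ and $i\in\{0,1,\ldots,\lceil\log_r(n-1)\rceil\}$, let $s^k_i(T)$ be the number of non-boundary edges $e$ of $T$ with $Q_T(e)$ of type-$k$ and $\sigma_e=i$. Define $c(T)=\Big(\sum_{i=0}^{\lceil\log_r(n-1)\rceil} 2i\, s^1_i(T)+\sum_{i=0}^{\lceil\log_r(n-1)\rceil} 3i\, s^2_i(T)\Big) \bmod \big(3\lceil\log_r n\rceil\big)$. -}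

module Defs where

open import Data.Nat using (ℕ; zero; suc; _+_; _*_; _∸_; _<_; _≤_; _≟_; _<ᵇ_; _≡ᵇ_; _%_)
open import Data.Bool using (Bool; true; false; _∧_; _∨_; not; if_then_else_)
open import Data.List using (List; []; _∷_; length; filter; upTo)
open import Data.Bool.ListAction using (any)
open import Data.List.Membership.Propositional using (_∈_)
open import Data.List.Relation.Unary.All using (All)
open import Data.List.Relation.Unary.AllPairs using (AllPairs)
open import Data.Product using (_×_; _,_; ∃; Σ; proj₁; proj₂)
open import Data.Sum using (_⊎_)
open import Data.Empty using (⊥)
open import Relation.Nullary using (¬_; _×-dec_)
open import Relation.Binary.PropositionalEquality using (_≡_; _≢_)
open import Data.Integer using (+_)
import Data.Rational as Q
open Q using (ℚ)

record Real : Set₁ where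
  field
    L U        : ℚ → Set
    L-inhabited : ∃ L
    U-inhabited : ∃ U
    L-lower    : ∀ {p q} → p Q.< q → L q → L p
    U-upper    : ∀ {p q} → p Q.< q → U p → U q
    L-rounded  : ∀ {q} → L q → ∃ λ p → q Q.< p × L p
    U-rounded  : ∀ {q} → U q → ∃ λ p → p Q.< q × U p
    disjoint   : ∀ {q} → L q → U q → ⊥
    located    : ∀ {p q} → p Q.< q → L p ⊎ U q
open Real public

OneLt : Real → Set
OneLt r = L r Q.1ℚ

qpow : ℚ → ℕ → ℚ
qpow q zero    = Q.1ℚ
qpow q (suc j) = q Q.* qpow q j

ℕtoℚ : ℕ → ℚ
ℕtoℚ m = + m Q./ 1

-- "r ^ j < m"  (for r > 1): some rational q > r has q ^ j < m
PowLt : Real → ℕ → ℕ → Set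
PowLt r j m = ∃ λ q → U r q × qpow q j Q.< ℕtoℚ m

-- IsCeilLog r m i  :  i = ⌈ log_r m ⌉   (m ≥ 1), i.e. m ≤ r^i and r^j < m for all j < i
IsCeilLog : Real → ℕ → ℕ → Set
IsCeilLog r m i = ¬ PowLt r i m × (∀ j → j < i → PowLt r j m)

IsScale : Real → (ℕ → ℕ) → Set
IsScale r σ = ∀ m → 1 ≤ m → IsCeilLog r m (σ m)

-- Triangulations of the convex n-gon with vertices 0 … n-1.
-- An edge is a pair (u , v) with u < v.

Edge : Set
Edge = ℕ × ℕ

IsDiag : ℕ → Edge → Set
IsDiag n (u , v) = u < v × v < n × 2 ≤ v ∸ u × ¬ (u ≡ 0 × suc v ≡ n)

Cross : Edge → Edge → Set
Cross (a , b) (c , d) = (a < c × c < b × b < d) ⊎ (c < a × a < d × d < b)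

record Triangulation (n : ℕ) : Set where
  field
    diags    : List Edge
    allDiag  : All (IsDiag n) diags
    distinct : AllPairs _≢_ diags
    nonCross : AllPairs (λ e f → ¬ Cross e f) diags
    maximal  : ∀ e → IsDiag n e → e ∈ diags ⊎ ∃ λ f → f ∈ diags × Cross e f
open Triangulation public

eqEdgeᵇ : Edge → Edge → Bool
eqEdgeᵇ (a , b) (c , d) = (a ≡ᵇ c) ∧ (b ≡ᵇ d)

elemᵇ : Edge → List Edge → Bool
elemᵇ e []       = false
elemᵇ e (f ∷ fs) = eqEdgeᵇ e f ∨ elemᵇ e fs

boundaryᵇ : ℕ → Edge → Bool
boundaryᵇ n (u , v) = ((suc u ≡ᵇ v) ∧ (v <ᵇ n)) ∨ ((u ≡ᵇ 0) ∧ (suc v ≡ᵇ n))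

isEdgeᵇ : ∀ {n} → Triangulation n → Edge → Bool
isEdgeᵇ {n} T e = boundaryᵇ n e ∨ elemᵇ e (diags T)

-- A diagonal uv (u < v) of T lies in a triangle u x v with u < x < v and in a
-- triangle u v y with y outside [u,v].  Its quadrilateral has sorted vertices
-- u < x < v < y (then e = AC: type-1) or y < u < x < v (then e = BD: type-2).
-- So e is type-1 iff the apex of the outer triangle is some y > v.
type1ᵇ : ∀ {n} → Triangulation n → Edge → Bool
type1ᵇ {n} T (u , v) =
  any (λ y → (v <ᵇ y) ∧ isEdgeᵇ T (u , y) ∧ isEdgeᵇ T (v , y)) (upTo n)

qtype : ∀ {n} → Triangulation n → Edge → ℕ
qtype T e = if type1ᵇ T e then 1 else 2

scale : (ℕ → ℕ) → Edge → ℕ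
scale σ (u , v) = σ (v ∸ u)

s : (ℕ → ℕ) → ∀ {n} → ℕ → ℕ → Triangulation n → ℕ
s σ k i T = length (filter (λ e → (qtype T e ≟ k) ×-dec (scale σ e ≟ i)) (diags T))

sumTo : ℕ → (ℕ → ℕ) → ℕ
sumTo zero    f = f 0
sumTo (suc K) f = sumTo K f + f (suc K)

-- x mod d (d = 0 never occurs in the theorem since σ n ≥ 1 there)
modℕ : ℕ → ℕ → ℕ
modℕ x zero    = x
modℕ x (suc d) = x % suc d

c : (ℕ → ℕ) → ∀ {n} → Triangulation n → ℕ
c σ {n} T =
  modℕ (sumTo (σ (n ∸ 1)) (λ i → 2 * i * s σ 1 i T)
        + sumTo (σ (n ∸ 1)) (λ i → 3 * i * s σ 2 i T))
       (3 * σ n)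

ExactlyTwoEqual : ℕ → ℕ → ℕ → Set
ExactlyTwoEqual a b d =
  (a ≡ b × b ≢ d) ⊎ (a ≡ d × a ≢ b) ⊎ (b ≡ d × a ≢ b)

module Submission where

-- Write a = σ_AC, b = σ_BD and d = σ_BC. The sum defining c(T) is the sum over the
-- diagonals e of 2σ_e (type 1) or 3σ_e (type 2). The flip removes the type-1 diagonal
-- AC, adds the type-2 diagonal BD, turns BC from type 2 into type 1 (if BC is a side
-- of the polygon instead, then d = ⌈log_r 1⌉ = 0), and keeps the type of every other
-- diagonal, since the outer triangle of such a diagonal either survives the flip or is
-- traded for another outer triangle. Hence c(T) and c(T') are the residues modulo
-- 3⌈log_r n⌉ of 2a + d + x and 3b + x for a common x. Both 2a + d and 3b lie in
-- [1, 3⌈log_r n⌉], so c(T) = c(T') forces 3b = 2a + d, which fails when exactly two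
-- of a, b, d are equal.

open import Defs
open import Data.Nat using (ℕ; zero; suc; _+_; _*_; _∸_; _<_; _≤_; _≟_; _%_; z≤n; s≤s; NonZero; >-nonZero)
open import Data.Nat.Properties
open import Data.Nat.Divisibility using (_∣_; n∣m*n; ∣m+n∣m⇒∣n; ∣⇒≤)
open import Data.Nat.DivMod using (_/_; m≡m%n+[m/n]*n)
open import Data.Nat.Coprimality using (1-coprimeTo) renaming (sym to coprime-sym)
open import Algebra.Properties.CommutativeSemigroup +-commutativeSemigroup
  using () renaming (interchange to +-interchange; xy∙z≈xz∙y to +-right-comm)
import Data.Integer as ℤ
import Data.Integer.Properties as ℤ
import Data.Rational as ℚ
import Data.Rational.Properties as ℚ
open import Data.Bool using (true; false; T; if_then_else_; _∨_)
open import Data.Bool.Properties using (T-≡; T-∧; T-∨)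
open import Data.Product using (_×_; _,_; ∃; proj₁; proj₂; uncurry)
open import Data.Product.Properties using (,-injective)
open import Data.Sum using (_⊎_; inj₁; inj₂)
open import Data.Empty using (⊥-elim)
open import Data.List using (List; []; _∷_; length; map; filter; upTo)
open import Data.List.Properties using (map-cong; map-cong-local)
open import Data.Nat.ListAction using (sum)
open import Data.Nat.ListAction.Properties using (sum-↭)
open import Data.List.Relation.Unary.Any using (here; there)
open import Data.List.Relation.Unary.Any.Properties using (any⁺; any⁻)
open import Data.List.Relation.Unary.All as All using (All; []; _∷_)
open import Data.List.Relation.Unary.AllPairs using (AllPairs; _∷_)
open import Data.List.Relation.Unary.Unique.Propositional using (Unique)
import Data.List.Relation.Unary.Unique.Propositional.Properties as Unique
open import Data.List.Membership.Propositional using (_∈_; find; lose)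
open import Data.List.Membership.Propositional.Properties using (∈-upTo⁺; ∈-filter⁺; ∈-filter⁻)
open import Data.List.Membership.Propositional.Properties.WithK using (unique∧set⇒bag)
open import Data.List.Relation.Binary.BagAndSetEquality using (∼bag⇒↭)
open import Data.List.Relation.Binary.Permutation.Propositional using (_↭_)
open import Data.List.Relation.Binary.Permutation.Propositional.Properties using (map⁺)
open import Function using (_∘_; Equivalence; _⇔_; mk⇔)
open import Relation.Binary.Definitions using (DecidableEquality; tri<; tri≈; tri>)
open import Relation.Binary.PropositionalEquality
  using (_≡_; _≢_; refl; sym; trans; cong; cong₂; subst; subst₂; module ≡-Reasoning)
open import Relation.Nullary using (¬_; Dec; does; yes; no; ¬?; _×-dec_; map′)
open import Relation.Nullary.Decidable using (dec-true; dec-false)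
open import Relation.Unary using (Decidable)

open Equivalence using (to; from)

T-injective : ∀ {x y} → (T x → T y) → (T y → T x) → x ≡ y
T-injective {false} {false} _ _ = refl
T-injective {false} {true}  _ g = ⊥-elim (g _)
T-injective {true}  {false} f _ = ⊥-elim (f _)
T-injective {true}  {true}  _ _ = refl

¬T⇒≡false : ∀ {x} → ¬ T x → x ≡ false
¬T⇒≡false {false} _ = refl
¬T⇒≡false {true}  f = ⊥-elim (f _)

T-does⇔ : ∀ {P : Set} (p? : Dec P) → T (does p?) ⇔ P
T-does⇔ (yes p) = mk⇔ (λ _ → p) _
T-does⇔ (no ¬p) = mk⇔ (λ ()) ¬p

-- Edges and their types

-- Chosen so that does (e ≟ᴱ f) reduces to eqEdgeᵇ e f; elemᵇ is then the decision
-- procedure _∈?_ for this equality.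
_≟ᴱ_ : DecidableEquality Edge
(a , b) ≟ᴱ (c , d) = map′ (uncurry (cong₂ _,_)) ,-injective (a ≟ c ×-dec b ≟ d)

open import Data.List.Membership.DecPropositional _≟ᴱ_ using (_∈?_)

elemᵇ≡does-∈? : ∀ e es → elemᵇ e es ≡ does (e ∈? es)
elemᵇ≡does-∈? e []       = refl
elemᵇ≡does-∈? e (f ∷ es) = cong (eqEdgeᵇ e f ∨_) (elemᵇ≡does-∈? e es)

elemᵇ⇔∈ : ∀ {e es} → T (elemᵇ e es) ⇔ e ∈ es
elemᵇ⇔∈ {e} {es} rewrite elemᵇ≡does-∈? e es = T-does⇔ (e ∈? es)

IsBoundary : ℕ → Edge → Set
IsBoundary n (u , v) = (suc u ≡ v × v < n) ⊎ (u ≡ 0 × suc v ≡ n)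

boundaryᵇ⇒IsBoundary : ∀ n e → T (boundaryᵇ n e) → IsBoundary n e
boundaryᵇ⇒IsBoundary n (u , v) h with to T-∨ h
... | inj₁ h′ = let p , q = to T-∧ h′ in inj₁ (≡ᵇ⇒≡ (suc u) v p , <ᵇ⇒< v n q)
... | inj₂ h′ = let p , q = to T-∧ h′ in inj₂ (≡ᵇ⇒≡ u 0 p , ≡ᵇ⇒≡ (suc v) n q)

IsEdge : ∀ {n} → Triangulation n → Edge → Set
IsEdge Δ e = T (isEdgeᵇ Δ e)

Cross-sym : ∀ e f → Cross e f → Cross f e
Cross-sym _ _ (inj₁ c) = inj₂ c
Cross-sym _ _ (inj₂ c) = inj₁ c

Cross-irrefl : ∀ e → ¬ Cross e e
Cross-irrefl _ (inj₁ (u<u , _)) = <-irrefl refl u<u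
Cross-irrefl _ (inj₂ (u<u , _)) = <-irrefl refl u<u

boundary-¬Cross : ∀ {n e c d} → IsBoundary n e → d < n → ¬ Cross e (c , d)
boundary-¬Cross (inj₁ (refl , _)) _ (inj₁ (u<c , c<u+1 , _)) = <-irrefl refl (<-≤-trans u<c (≤-pred c<u+1))
boundary-¬Cross (inj₁ (refl , _)) _ (inj₂ (_ , u<d , d<u+1)) = <-irrefl refl (<-≤-trans u<d (≤-pred d<u+1))
boundary-¬Cross (inj₂ (refl , refl)) d<n (inj₁ (_ , _ , n-1<d)) = <-irrefl refl (<-≤-trans n-1<d (≤-pred d<n))
boundary-¬Cross (inj₂ (refl , refl)) _ (inj₂ (() , _))

AllPairs-∈ : ∀ {A : Set} {R : A → A → Set} {xs x y} →
             (∀ {z} → R z z) → (∀ {z w} → R z w → R w z) → AllPairs R xs → x ∈ xs → y ∈ xs → R x y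
AllPairs-∈ R-refl R-sym (_ ∷ _)      (here refl) (here refl) = R-refl
AllPairs-∈ R-refl R-sym (Rx ∷ _)     (here refl) (there y∈) = All.lookup Rx y∈
AllPairs-∈ R-refl R-sym (Ry ∷ _)     (there x∈) (here refl) = R-sym (All.lookup Ry x∈)
AllPairs-∈ R-refl R-sym (_ ∷ pairs) (there x∈) (there y∈) = AllPairs-∈ R-refl R-sym pairs x∈ y∈

module _ {n : ℕ} (Δ : Triangulation n) where

  diag⇒IsEdge : ∀ {e} → e ∈ diags Δ → IsEdge Δ e
  diag⇒IsEdge e∈Δ = from T-∨ (inj₂ (from elemᵇ⇔∈ e∈Δ))

  diag⇒< : ∀ {u v} → (u , v) ∈ diags Δ → u < v
  diag⇒< uv∈Δ = proj₁ (All.lookup (allDiag Δ) uv∈Δ)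

  IsEdge⇒boundary⊎diag : ∀ {e} → IsEdge Δ e → IsBoundary n e ⊎ e ∈ diags Δ
  IsEdge⇒boundary⊎diag {e} h with to T-∨ h
  ... | inj₁ h′ = inj₁ (boundaryᵇ⇒IsBoundary n e h′)
  ... | inj₂ h′ = inj₂ (to elemᵇ⇔∈ h′)

  IsEdge⇒<n : ∀ {u v} → IsEdge Δ (u , v) → v < n
  IsEdge⇒<n h with IsEdge⇒boundary⊎diag h
  ... | inj₁ (inj₁ (_ , v<n))  = v<n
  ... | inj₁ (inj₂ (_ , refl)) = ≤-refl
  ... | inj₂ uv∈Δ              = proj₁ (proj₂ (All.lookup (allDiag Δ) uv∈Δ))

  edges-¬Cross : ∀ {e f} → IsEdge Δ e → IsEdge Δ f → ¬ Cross e f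
  edges-¬Cross {e} {f@(_ , _)} he hf with IsEdge⇒boundary⊎diag he | IsEdge⇒boundary⊎diag hf
  ... | inj₁ e-bd | _         = boundary-¬Cross e-bd (IsEdge⇒<n hf)
  ... | inj₂ _    | inj₁ f-bd = boundary-¬Cross f-bd (IsEdge⇒<n he) ∘ Cross-sym e f
  ... | inj₂ e∈Δ  | inj₂ f∈Δ  =
    AllPairs-∈ (Cross-irrefl _) (λ {z} {w} ¬zw → ¬zw ∘ Cross-sym w z) (nonCross Δ) e∈Δ f∈Δ

  HasOuterApex : Edge → Set
  HasOuterApex (u , v) = ∃ λ y → v < y × IsEdge Δ (u , y) × IsEdge Δ (v , y)

  type1ᵇ⇔HasOuterApex : ∀ {u v} → T (type1ᵇ Δ (u , v)) ⇔ HasOuterApex (u , v)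
  type1ᵇ⇔HasOuterApex {u} {v} = mk⇔ apex type1
    where
    apex : T (type1ᵇ Δ (u , v)) → HasOuterApex (u , v)
    apex h with find (any⁻ _ (upTo n) h)
    ... | y , _ , t = let v<y , t′ = to T-∧ t ; uy , vy = to T-∧ t′ in y , <ᵇ⇒< v y v<y , uy , vy
    type1 : HasOuterApex (u , v) → T (type1ᵇ Δ (u , v))
    type1 (y , v<y , uy , vy) =
      any⁺ _ (lose (∈-upTo⁺ (IsEdge⇒<n vy)) (from T-∧ (<⇒<ᵇ v<y , from T-∧ (uy , vy))))

  below-edge⇒¬HasOuterApex : ∀ {a u v} → IsEdge Δ (a , v) → a < u → u < v → ¬ HasOuterApex (u , v)
  below-edge⇒¬HasOuterApex av a<u u<v (_ , v<y , uy , _) = edges-¬Cross av uy (inj₁ (a<u , u<v , v<y))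

sumTo-cong : ∀ K {f g : ℕ → ℕ} → (∀ i → i ≤ K → f i ≡ g i) → sumTo K f ≡ sumTo K g
sumTo-cong zero    f≡g = f≡g 0 z≤n
sumTo-cong (suc K) f≡g = cong₂ _+_ (sumTo-cong K (λ i → f≡g i ∘ m≤n⇒m≤1+n)) (f≡g (suc K) ≤-refl)

sumTo-zero : ∀ K {f : ℕ → ℕ} → (∀ i → i ≤ K → f i ≡ 0) → sumTo K f ≡ 0
sumTo-zero zero    f≡0 = f≡0 0 z≤n
sumTo-zero (suc K) f≡0 = cong₂ _+_ (sumTo-zero K (λ i → f≡0 i ∘ m≤n⇒m≤1+n)) (f≡0 (suc K) ≤-refl)

sumTo-+ : ∀ K (f g : ℕ → ℕ) → sumTo K (λ i → f i + g i) ≡ sumTo K f + sumTo K g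
sumTo-+ zero    f g = refl
sumTo-+ (suc K) f g = trans (cong (_+ (f (suc K) + g (suc K))) (sumTo-+ K f g))
                            (+-interchange (sumTo K f) (sumTo K g) (f (suc K)) (g (suc K)))

sumTo-single : ∀ K {m} (f : ℕ → ℕ) → m ≤ K → sumTo K (λ i → if does (m ≟ i) then f i else 0) ≡ f m
sumTo-single zero        f z≤n = refl
sumTo-single (suc K) {m} f m≤1+K with m≤n⇒m<n∨m≡n m≤1+K
... | inj₁ m<1+K = trans
  (cong₂ _+_ (sumTo-single K f (≤-pred m<1+K))
             (cong (if_then f (suc K) else 0) (dec-false (m ≟ suc K) (<⇒≢ m<1+K))))
  (+-identityʳ (f m))
... | inj₂ refl =
  cong₂ _+_ (sumTo-zero K (λ i i≤K → cong (if_then f i else 0) (dec-false (m ≟ i) (>⇒≢ (s≤s i≤K)))))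
            (cong (if_then f m else 0) (dec-true (m ≟ m) refl))

sum-map-+ : ∀ {A : Set} (f g : A → ℕ) xs →
            sum (map (λ x → f x + g x) xs) ≡ sum (map f xs) + sum (map g xs)
sum-map-+ f g []       = refl
sum-map-+ f g (x ∷ xs) = trans (cong (f x + g x +_) (sum-map-+ f g xs))
                               (+-interchange (f x) (g x) (sum (map f xs)) (sum (map g xs)))

k*length-filter-∷ : ∀ {A : Set} {P : A → Set} k (P? : Decidable P) x xs →
  k * length (filter P? (x ∷ xs)) ≡ (if does (P? x) then k else 0) + k * length (filter P? xs)
k*length-filter-∷ k P? x xs with does (P? x)
... | true  = *-suc k _
... | false = refl

sumTo-weightedCount : ∀ {A : Set} {P : A → Set} (P? : Decidable P) (g : A → ℕ) k K xs →
  All (λ x → g x ≤ K) xs →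
  sumTo K (λ i → k * i * length (filter (λ x → P? x ×-dec (g x ≟ i)) xs))
    ≡ sum (map (λ x → if does (P? x) then k * g x else 0) xs)
sumTo-weightedCount P? g k K []       []              = sumTo-zero K (λ i _ → *-zeroʳ (k * i))
sumTo-weightedCount {P = P} P? g k K (x ∷ xs) (gx≤K ∷ gxs≤K) = begin
  sumTo K (λ i → k * i * length (filter (Q i) (x ∷ xs)))
    ≡⟨ sumTo-cong K (λ i _ → k*length-filter-∷ (k * i) (Q i) x xs) ⟩
  sumTo K (λ i → (if does (Q i x) then k * i else 0) + k * i * length (filter (Q i) xs))
    ≡⟨ sumTo-+ K _ _ ⟩
  sumTo K (λ i → if does (Q i x) then k * i else 0) + sumTo K (λ i → k * i * length (filter (Q i) xs))
    ≡⟨ cong₂ _+_ x-column (sumTo-weightedCount P? g k K xs gxs≤K) ⟩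
  (if does (P? x) then k * g x else 0) + sum (map (λ x → if does (P? x) then k * g x else 0) xs) ∎
  where
  open ≡-Reasoning
  Q : ∀ i → Decidable (λ x → P x × g x ≡ i)
  Q i x = P? x ×-dec (g x ≟ i)
  x-column : sumTo K (λ i → if does (Q i x) then k * i else 0) ≡ (if does (P? x) then k * g x else 0)
  x-column with does (P? x)
  ... | true  = sumTo-single K (k *_) gx≤K
  ... | false = sumTo-zero K (λ _ _ → refl)

_without_ : List Edge → Edge → List Edge
es without e = filter (λ f → ¬? (f ≟ᴱ e)) es

module _ {es : List Edge} {e : Edge} where

  ∈-without⁺ : ∀ {f} → f ∈ es → f ≢ e → f ∈ es without e
  ∈-without⁺ = ∈-filter⁺ (λ f → ¬? (f ≟ᴱ e))

  ∈-without⁻ : ∀ {f} → f ∈ es without e → f ∈ es × f ≢ e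
  ∈-without⁻ = ∈-filter⁻ (λ f → ¬? (f ≟ᴱ e))

  unique-without : Unique es → Unique (es without e)
  unique-without = Unique.filter⁺ (λ f → ¬? (f ≟ᴱ e))

↭-of-same-members : ∀ {A : Set} {xs ys : List A} →
                    Unique xs → Unique ys → (∀ {z} → z ∈ xs ⇔ z ∈ ys) → xs ↭ ys
↭-of-same-members xs! ys! same = ∼bag⇒↭ (unique∧set⇒bag xs! ys! same)

without-↭ : ∀ {es e} → Unique es → e ∈ es → es ↭ e ∷ (es without e)
without-↭ {es} {e} es! e∈es = ↭-of-same-members es! (e∉ ∷ unique-without es!) (mk⇔ split join)
  where
  e∉ : All (e ≢_) (es without e)
  e∉ = All.tabulate (λ f∈ e≡f → proj₂ (∈-without⁻ {es} f∈) (sym e≡f))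
  split : ∀ {f} → f ∈ es → f ∈ e ∷ (es without e)
  split {f} f∈es with f ≟ᴱ e
  ... | yes refl = here refl
  ... | no f≢e   = there (∈-without⁺ f∈es f≢e)
  join : ∀ {f} → f ∈ e ∷ (es without e) → f ∈ es
  join (here refl) = e∈es
  join (there f∈)  = proj₁ (∈-without⁻ {es} f∈)

sum-without : ∀ (f : Edge → ℕ) {es e} → Unique es → e ∈ es →
              sum (map f es) ≡ f e + sum (map f (es without e))
sum-without f es! e∈es = sum-↭ (map⁺ f (without-↭ es! e∈es))

-- Arithmetic modulo 3 σ(n)

modℕ-nonZero : ∀ x M .{{_ : NonZero M}} → modℕ x M ≡ x % M
modℕ-nonZero x (suc M) = refl

%-shift≡⇒0 : ∀ M .{{_ : NonZero M}} Y {t} → (Y + t) % M ≡ Y % M → t < M → t ≡ 0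
%-shift≡⇒0 M Y {zero}  _  _   = refl
%-shift≡⇒0 M Y {suc t} eq t<M = ⊥-elim (<⇒≱ t<M (∣⇒≤ M∣t))
  where
  open ≡-Reasoning
  k₀M+t≡k₁M : Y / M * M + suc t ≡ (Y + suc t) / M * M
  k₀M+t≡k₁M = +-cancelˡ-≡ (Y % M) _ _ (begin
    Y % M + (Y / M * M + suc t)           ≡⟨ +-assoc (Y % M) (Y / M * M) (suc t) ⟨
    Y % M + Y / M * M + suc t             ≡⟨ cong (_+ suc t) (m≡m%n+[m/n]*n Y M) ⟨
    Y + suc t                             ≡⟨ m≡m%n+[m/n]*n (Y + suc t) M ⟩
    (Y + suc t) % M + (Y + suc t) / M * M ≡⟨ cong (_+ (Y + suc t) / M * M) eq ⟩
    Y % M + (Y + suc t) / M * M           ∎)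
  M∣t : M ∣ suc t
  M∣t = ∣m+n∣m⇒∣n (subst (M ∣_) (sym k₀M+t≡k₁M) (n∣m*n ((Y + suc t) / M))) (n∣m*n (Y / M))

%-injective-≤ : ∀ M .{{_ : NonZero M}} X {p q} → 0 < p → q ≤ M → p ≤ q →
                (p + X) % M ≡ (q + X) % M → p ≡ q
%-injective-≤ M X {p} 0<p q≤M p≤q eq with m≤n⇒∃[o]m+o≡n p≤q
... | t , refl = sym (trans (cong (p +_) t≡0) (+-identityʳ p))
  where
  t≡0 : t ≡ 0
  t≡0 = %-shift≡⇒0 M (p + X) (trans (cong (_% M) (+-right-comm p X t)) (sym eq))
                    (<-≤-trans (m<n+m t 0<p) q≤M)

%-injective-window : ∀ M .{{_ : NonZero M}} X {p q} → 0 < p → 0 < q → p ≤ M → q ≤ M →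
                     (p + X) % M ≡ (q + X) % M → p ≡ q
%-injective-window M X 0<p 0<q p≤M q≤M eq with ≤-total _ _
... | inj₁ p≤q = %-injective-≤ M X 0<p q≤M p≤q eq
... | inj₂ q≤p = sym (%-injective-≤ M X 0<q p≤M q≤p (sym eq))

ExactlyTwoEqual⇒3b≢2a+d : ∀ {a b d} → ExactlyTwoEqual a b d → 3 * b ≢ 2 * a + d
ExactlyTwoEqual⇒3b≢2a+d {b = b} (inj₁ (refl , b≢d)) 3b≡2b+d =
  b≢d (+-cancelˡ-≡ (2 * b) b _ (trans (+-comm (2 * b) b) 3b≡2b+d))
ExactlyTwoEqual⇒3b≢2a+d {a} {b} (inj₂ (inj₁ (refl , a≢b))) 3b≡2a+a =
  a≢b (sym (*-cancelˡ-≡ b a 3 (trans 3b≡2a+a (+-comm (2 * a) a))))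
ExactlyTwoEqual⇒3b≢2a+d {a} {b} (inj₂ (inj₂ (refl , a≢b))) 3b≡2a+b =
  a≢b (sym (*-cancelˡ-≡ b a 2 (+-cancelˡ-≡ b (2 * b) (2 * a) (trans 3b≡2a+b (+-comm (2 * a) b)))))

ExactlyTwoEqual⇒3b+x≢2a+d+x-mod-3s : ∀ {a b d s} x → 0 < a → 0 < b → a ≤ s → b ≤ s → d ≤ s →
  ExactlyTwoEqual a b d → modℕ (3 * b + x) (3 * s) ≢ modℕ (2 * a + d + x) (3 * s)
ExactlyTwoEqual⇒3b+x≢2a+d+x-mod-3s {a} {b} {d} {s} x 0<a 0<b a≤s b≤s d≤s exactlyTwo eq =
  ExactlyTwoEqual⇒3b≢2a+d exactlyTwo (%-injective-window (3 * s) x 0<3b 0<2a+d 3b≤3s 2a+d≤3s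
    (trans (sym (modℕ-nonZero _ (3 * s))) (trans eq (modℕ-nonZero _ (3 * s)))))
  where
  instance
    3s≢0 : NonZero (3 * s)
    3s≢0 = >-nonZero (<-≤-trans 0<b (≤-trans b≤s (m≤n*m s 3)))
  0<3b : 0 < 3 * b
  0<3b = <-≤-trans 0<b (m≤n*m b 3)
  0<2a+d : 0 < 2 * a + d
  0<2a+d = <-≤-trans 0<a (≤-trans (m≤n*m a 2) (m≤m+n (2 * a) d))
  3b≤3s : 3 * b ≤ 3 * s
  3b≤3s = *-monoʳ-≤ 3 b≤s
  2a+d≤3s : 2 * a + d ≤ 3 * s
  2a+d≤3s = ≤-trans (+-mono-≤ (*-monoʳ-≤ 2 a≤s) d≤s) (≤-reflexive (+-comm (2 * s) s))

-- The cost as a weighted sum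

weight : (ℕ → ℕ) → ∀ {n} → Triangulation n → Edge → ℕ
weight σ Δ e = if type1ᵇ Δ e then 2 * scale σ e else 3 * scale σ e

weightSum : (ℕ → ℕ) → ∀ {n} → Triangulation n → List Edge → ℕ
weightSum σ Δ es = sum (map (weight σ Δ) es)

module _ (σ : ℕ → ℕ) {n : ℕ} (Δ : Triangulation n) (e : Edge) where

  weight-type1 : type1ᵇ Δ e ≡ true → weight σ Δ e ≡ 2 * scale σ e
  weight-type1 = cong (if_then 2 * scale σ e else 3 * scale σ e)

  weight-type2 : type1ᵇ Δ e ≡ false → weight σ Δ e ≡ 3 * scale σ e
  weight-type2 = cong (if_then 2 * scale σ e else 3 * scale σ e)

weightSum-cong : ∀ σ {n} (Δ Δ′ : Triangulation n) {es} →
  (∀ {e} → e ∈ es → weight σ Δ e ≡ weight σ Δ′ e) → weightSum σ Δ es ≡ weightSum σ Δ′ es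
weightSum-cong σ Δ Δ′ agree = cong sum (map-cong-local (All.tabulate agree))

ℕtoℚ-mono-≤ : ∀ {m m′} → m ≤ m′ → ℕtoℚ m ℚ.≤ ℕtoℚ m′
ℕtoℚ-mono-≤ {m} {m′} m≤m′
  rewrite ℚ.normalize-coprime (coprime-sym (1-coprimeTo m))
        | ℚ.normalize-coprime (coprime-sym (1-coprimeTo m′))
  = ℚ.*≤* (subst₂ ℤ._≤_ (sym (ℤ.*-identityʳ _)) (sym (ℤ.*-identityʳ _)) (ℤ.+≤+ m≤m′))

module Scale {r : Real} {σ : ℕ → ℕ} (σ-isScale : IsScale r σ) where

  σ-mono-≤ : ∀ {m m′} → 1 ≤ m → m ≤ m′ → σ m ≤ σ m′
  σ-mono-≤ {m} {m′} 1≤m m≤m′ = ≮⇒≥ λ σm′<σm →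
    let q , q∈U , q^σm′<m = proj₂ (σ-isScale m 1≤m) (σ m′) σm′<σm
    in proj₁ (σ-isScale m′ (≤-trans 1≤m m≤m′))
             (q , q∈U , ℚ.<-≤-trans q^σm′<m (ℕtoℚ-mono-≤ m≤m′))

  σ-1≡0 : σ 1 ≡ 0
  σ-1≡0 = n≤0⇒n≡0 (≮⇒≥ λ 0<σ1 →
    let _ , _ , 1<1 = proj₂ (σ-isScale 1 ≤-refl) 0 0<σ1 in ℚ.<-irrefl refl 1<1)

  σ-positive : ∀ {m} → 2 ≤ m → 0 < σ m
  σ-positive {m} 2≤m = n≢0⇒n>0 λ σm≡0 →
    let q , q∈U = U-inhabited r
        r⁰<m : PowLt r 0 m
        r⁰<m = q , q∈U , ℚ.<-≤-trans (ℚ.*<* (ℤ.+<+ (s≤s (s≤s z≤n)))) (ℕtoℚ-mono-≤ 2≤m)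
    in proj₁ (σ-isScale m (≤-trans (s≤s z≤n) 2≤m)) (subst (λ i → PowLt r i m) (sym σm≡0) r⁰<m)

  σ-gap-positive : ∀ {x y z} → x < y → y < z → 0 < σ (z ∸ x)
  σ-gap-positive {x} {z = z} x<y y<z =
    σ-positive (subst (_≤ z ∸ x) (m+n∸n≡m 2 x) (∸-monoˡ-≤ x (≤-trans (s≤s x<y) y<z)))

  σ-chord≤σ : ∀ {n u v} → u < v → v ≤ n → σ (v ∸ u) ≤ σ n
  σ-chord≤σ {u = u} {v} u<v v≤n = σ-mono-≤ (m<n⇒0<n∸m u<v) (≤-trans (m∸n≤m v u) v≤n)

  c≡weightSum : ∀ {n} (Δ : Triangulation n) → c σ Δ ≡ modℕ (weightSum σ Δ (diags Δ)) (3 * σ n)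
  c≡weightSum {n} Δ = cong (λ x → modℕ x (3 * σ n)) (begin
    sumTo K (λ i → 2 * i * s σ 1 i Δ) + sumTo K (λ i → 3 * i * s σ 2 i Δ)
      ≡⟨ cong₂ _+_ (sumTo-weightedCount (λ e → qtype Δ e ≟ 1) (scale σ) 2 K (diags Δ) scales≤)
                   (sumTo-weightedCount (λ e → qtype Δ e ≟ 2) (scale σ) 3 K (diags Δ) scales≤) ⟩
    sum (map type-1-part (diags Δ)) + sum (map type-2-part (diags Δ))
      ≡⟨ sum-map-+ type-1-part type-2-part (diags Δ) ⟨
    sum (map (λ e → type-1-part e + type-2-part e) (diags Δ))
      ≡⟨ cong sum (map-cong parts≡weight (diags Δ)) ⟩
    weightSum σ Δ (diags Δ) ∎)
    where
    open ≡-Reasoning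
    K : ℕ
    K = σ (n ∸ 1)
    scales≤ : All (λ e → scale σ e ≤ K) (diags Δ)
    scales≤ = All.map (λ (u<v , v<n , _) → σ-chord≤σ u<v (∸-monoˡ-≤ 1 v<n)) (allDiag Δ)
    type-1-part type-2-part : Edge → ℕ
    type-1-part e = if does (qtype Δ e ≟ 1) then 2 * scale σ e else 0
    type-2-part e = if does (qtype Δ e ≟ 2) then 3 * scale σ e else 0
    parts≡weight : ∀ e → type-1-part e + type-2-part e ≡ weight σ Δ e
    parts≡weight e with type1ᵇ Δ e
    ... | true  = +-identityʳ _
    ... | false = refl

-- The flip

module Flip {n : ℕ} (Δ Δ′ : Triangulation n) {A B C D : ℕ}
  (A<B : A < B) (B<C : B < C) (C<D : C < D) (AC∈Δ : (A , C) ∈ diags Δ)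
  (AB : IsEdge Δ (A , B)) (BC : IsEdge Δ (B , C)) (CD : IsEdge Δ (C , D)) (AD : IsEdge Δ (A , D))
  (Δ′⊆ : ∀ e → e ∈ diags Δ′ → (e ∈ diags Δ × e ≢ (A , C)) ⊎ e ≡ (B , D))
  (⊆Δ′ : ∀ e → (e ∈ diags Δ × e ≢ (A , C)) ⊎ e ≡ (B , D) → e ∈ diags Δ′) where

  A<C : A < C
  A<C = <-trans A<B B<C

  B<D : B < D
  B<D = <-trans B<C C<D

  edge-kept : ∀ {e} → IsEdge Δ e → e ≢ (A , C) → IsEdge Δ′ e
  edge-kept {e} h e≢AC with to T-∨ h
  ... | inj₁ e-bd = from T-∨ (inj₁ e-bd)
  ... | inj₂ e∈Δ  = diag⇒IsEdge Δ′ (⊆Δ′ e (inj₁ (to elemᵇ⇔∈ e∈Δ , e≢AC)))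

  edge-restored : ∀ {e} → IsEdge Δ′ e → IsEdge Δ e ⊎ e ≡ (B , D)
  edge-restored {e} h with to T-∨ h
  ... | inj₁ e-bd = inj₁ (from T-∨ (inj₁ e-bd))
  ... | inj₂ e∈Δ′ with Δ′⊆ e (to elemᵇ⇔∈ e∈Δ′)
  ...   | inj₁ (e∈Δ , _) = inj₁ (diag⇒IsEdge Δ e∈Δ)
  ...   | inj₂ e≡BD      = inj₂ e≡BD

  AC : IsEdge Δ (A , C)
  AC = diag⇒IsEdge Δ AC∈Δ

  ¬BD : ¬ IsEdge Δ (B , D)
  ¬BD BD = edges-¬Cross Δ AC BD (inj₁ (A<B , B<C , C<D))

  BD′ : IsEdge Δ′ (B , D)
  BD′ = diag⇒IsEdge Δ′ (⊆Δ′ _ (inj₂ refl))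

  AB′ : IsEdge Δ′ (A , B)
  AB′ = edge-kept AB (λ AB≡AC → <-irrefl (cong proj₂ AB≡AC) B<C)

  BC′ : IsEdge Δ′ (B , C)
  BC′ = edge-kept BC (λ BC≡AC → <-irrefl (sym (cong proj₁ BC≡AC)) A<B)

  CD′ : IsEdge Δ′ (C , D)
  CD′ = edge-kept CD (λ CD≡AC → <-irrefl (sym (cong proj₁ CD≡AC)) A<C)

  AD′ : IsEdge Δ′ (A , D)
  AD′ = edge-kept AD (λ AD≡AC → <-irrefl (sym (cong proj₂ AD≡AC)) C<D)

  AC-type1 : type1ᵇ Δ (A , C) ≡ true
  AC-type1 = to T-≡ (from (type1ᵇ⇔HasOuterApex Δ) (D , C<D , AD , CD))

  BC-type2 : type1ᵇ Δ (B , C) ≡ false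
  BC-type2 = ¬T⇒≡false (below-edge⇒¬HasOuterApex Δ AC A<B B<C ∘ to (type1ᵇ⇔HasOuterApex Δ))

  BD-type2′ : type1ᵇ Δ′ (B , D) ≡ false
  BD-type2′ = ¬T⇒≡false (below-edge⇒¬HasOuterApex Δ′ AD′ A<B B<D ∘ to (type1ᵇ⇔HasOuterApex Δ′))

  BC-type1′ : type1ᵇ Δ′ (B , C) ≡ true
  BC-type1′ = to T-≡ (from (type1ᵇ⇔HasOuterApex Δ′) (D , C<D , BD′ , CD′))

  -- An outer triangle u v y survives the flip unless AC (resp. BD) is one of its sides;
  -- non-crossing then forces u v = A B, whose outer apex moves from C to D (resp. back),
  -- or u v = B C.
  apex-kept : ∀ {u v} → (u , v) ∈ diags Δ → HasOuterApex Δ (u , v) → HasOuterApex Δ′ (u , v)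
  apex-kept {u} {v} uv∈Δ (y , v<y , uy , vy) with (u , y) ≟ᴱ (A , C) | (v , y) ≟ᴱ (A , C)
  ... | no uy≢AC | no vy≢AC = y , v<y , edge-kept uy uy≢AC , edge-kept vy vy≢AC
  ... | no _     | yes refl = ⊥-elim (edges-¬Cross Δ uy AD (inj₁ (diag⇒< Δ uv∈Δ , A<C , C<D)))
  ... | yes refl | _ with <-cmp v B
  ...   | tri< v<B _ _  = ⊥-elim (edges-¬Cross Δ vy AB (inj₂ (diag⇒< Δ uv∈Δ , v<B , B<C)))
  ...   | tri≈ _ refl _ = D , B<D , AD′ , BD′
  ...   | tri> _ _ B<v  = ⊥-elim (edges-¬Cross Δ (diag⇒IsEdge Δ uv∈Δ) BC (inj₁ (A<B , B<v , v<y)))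

  apex-restored : ∀ {u v} → (u , v) ∈ diags Δ → (u , v) ≢ (A , C) → (u , v) ≢ (B , C) →
                  HasOuterApex Δ′ (u , v) → HasOuterApex Δ (u , v)
  apex-restored {u} {v} uv∈Δ uv≢AC uv≢BC (y , v<y , uy′ , vy′) with edge-restored uy′ | edge-restored vy′
  ... | inj₁ uy   | inj₁ vy = y , v<y , uy , vy
  ... | inj₂ refl | _ with <-cmp v C
  ...   | tri< v<C _ _  = ⊥-elim (edges-¬Cross Δ′ vy′ BC′ (inj₂ (diag⇒< Δ uv∈Δ , v<C , C<D)))
  ...   | tri≈ _ refl _ = ⊥-elim (uv≢BC refl)
  ...   | tri> _ _ C<v  = ⊥-elim (edges-¬Cross Δ′ uv′ CD′ (inj₁ (B<C , C<v , v<y)))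
    where uv′ = edge-kept (diag⇒IsEdge Δ uv∈Δ) uv≢AC
  apex-restored {u} {v} uv∈Δ uv≢AC uv≢BC (y , v<y , uy′ , vy′) | inj₁ _ | inj₂ refl with <-cmp u A
  ...   | tri< u<A _ _  = ⊥-elim (edges-¬Cross Δ′ uv′ AD′ (inj₁ (u<A , A<B , B<D)))
    where uv′ = edge-kept (diag⇒IsEdge Δ uv∈Δ) uv≢AC
  ...   | tri≈ _ refl _ = C , B<C , AC , BC
  ...   | tri> _ _ A<u  = ⊥-elim (edges-¬Cross Δ′ AB′ uy′ (inj₁ (A<u , diag⇒< Δ uv∈Δ , v<y)))

  type1-preserved : ∀ {e} → e ∈ diags Δ → e ≢ (A , C) → e ≢ (B , C) → type1ᵇ Δ e ≡ type1ᵇ Δ′ e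
  type1-preserved {_ , _} e∈Δ e≢AC e≢BC = T-injective
    (from (type1ᵇ⇔HasOuterApex Δ′) ∘ apex-kept e∈Δ ∘ to (type1ᵇ⇔HasOuterApex Δ))
    (from (type1ᵇ⇔HasOuterApex Δ) ∘ apex-restored e∈Δ e≢AC e≢BC ∘ to (type1ᵇ⇔HasOuterApex Δ′))

  R : List Edge
  R = diags Δ without (A , C)

  diags′↭ : diags Δ′ ↭ (B , D) ∷ R
  diags′↭ = ↭-of-same-members (distinct Δ′) (BD∉R ∷ unique-without (distinct Δ)) (mk⇔ split join)
    where
    BD∉R : All ((B , D) ≢_) R
    BD∉R = All.tabulate λ e∈R BD≡e →
      ¬BD (diag⇒IsEdge Δ (subst (_∈ diags Δ) (sym BD≡e) (proj₁ (∈-without⁻ {diags Δ} e∈R))))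
    split : ∀ {e} → e ∈ diags Δ′ → e ∈ (B , D) ∷ R
    split {e} e∈Δ′ with Δ′⊆ e e∈Δ′
    ... | inj₁ (e∈Δ , e≢AC) = there (∈-without⁺ e∈Δ e≢AC)
    ... | inj₂ refl          = here refl
    join : ∀ {e} → e ∈ (B , D) ∷ R → e ∈ diags Δ′
    join (here refl) = ⊆Δ′ _ (inj₂ refl)
    join (there e∈R) = ⊆Δ′ _ (inj₁ (∈-without⁻ {diags Δ} e∈R))

  module Cost {r : Real} {σ : ℕ → ℕ} (σ-isScale : IsScale r σ) where
    open Scale {r} {σ} σ-isScale

    weights-agree : ∀ {e} → e ∈ R → e ≢ (B , C) → weight σ Δ e ≡ weight σ Δ′ e
    weights-agree {e} e∈R e≢BC =
      let e∈Δ , e≢AC = ∈-without⁻ {diags Δ} e∈R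
      in cong (λ t → if t then 2 * scale σ e else 3 * scale σ e) (type1-preserved e∈Δ e≢AC e≢BC)

    weightSum-Δ : weightSum σ Δ (diags Δ) ≡ 2 * σ (C ∸ A) + weightSum σ Δ R
    weightSum-Δ = trans (sum-without (weight σ Δ) (distinct Δ) AC∈Δ)
                        (cong (_+ weightSum σ Δ R) (weight-type1 σ Δ (A , C) AC-type1))

    weightSum-Δ′ : weightSum σ Δ′ (diags Δ′) ≡ 3 * σ (D ∸ B) + weightSum σ Δ′ R
    weightSum-Δ′ = trans (sum-↭ (map⁺ (weight σ Δ′) diags′↭))
                         (cong (_+ weightSum σ Δ′ R) (weight-type2 σ Δ′ (B , D) BD-type2′))

    weightSum-R-sideBC : suc B ≡ C → weightSum σ Δ R ≡ σ (C ∸ B) + weightSum σ Δ′ R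
    weightSum-R-sideBC 1+B≡C =
      trans (weightSum-cong σ Δ Δ′ agree)
            (cong (_+ weightSum σ Δ′ R) (sym (trans (cong σ C∸B≡1) σ-1≡0)))
      where
      C∸B≡1 : C ∸ B ≡ 1
      C∸B≡1 = trans (cong (_∸ B) (sym 1+B≡C)) (m+n∸n≡m 1 B)
      BC∉Δ : ¬ (B , C) ∈ diags Δ
      BC∉Δ BC∈Δ = let _ , _ , 2≤C∸B , _ = All.lookup (allDiag Δ) BC∈Δ
                  in 1+n≰n (subst (2 ≤_) C∸B≡1 2≤C∸B)
      agree : ∀ {e} → e ∈ R → weight σ Δ e ≡ weight σ Δ′ e
      agree e∈R = weights-agree e∈R λ e≡BC →
        BC∉Δ (subst (_∈ diags Δ) e≡BC (proj₁ (∈-without⁻ {diags Δ} e∈R)))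

    weightSum-R-diagBC : (B , C) ∈ diags Δ → weightSum σ Δ R ≡ σ (C ∸ B) + weightSum σ Δ′ R
    weightSum-R-diagBC BC∈Δ = begin
      weightSum σ Δ R
        ≡⟨ sum-without (weight σ Δ) R! BC∈R ⟩
      weight σ Δ (B , C) + weightSum σ Δ R₀
        ≡⟨ cong₂ _+_ (weight-type2 σ Δ (B , C) BC-type2) (weightSum-cong σ Δ Δ′ agree) ⟩
      3 * d + weightSum σ Δ′ R₀
        ≡⟨ +-assoc d (2 * d) _ ⟩
      d + (2 * d + weightSum σ Δ′ R₀)
        ≡⟨ cong (λ w → d + (w + weightSum σ Δ′ R₀)) (weight-type1 σ Δ′ (B , C) BC-type1′) ⟨
      d + (weight σ Δ′ (B , C) + weightSum σ Δ′ R₀)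
        ≡⟨ cong (d +_) (sum-without (weight σ Δ′) R! BC∈R) ⟨
      d + weightSum σ Δ′ R ∎
      where
      open ≡-Reasoning
      d : ℕ
      d = σ (C ∸ B)
      R₀ : List Edge
      R₀ = R without (B , C)
      R! : Unique R
      R! = unique-without (distinct Δ)
      BC∈R : (B , C) ∈ R
      BC∈R = ∈-without⁺ BC∈Δ (λ BC≡AC → <-irrefl (sym (cong proj₁ BC≡AC)) A<B)
      agree : ∀ {e} → e ∈ R₀ → weight σ Δ e ≡ weight σ Δ′ e
      agree e∈R₀ = let e∈R , e≢BC = ∈-without⁻ {R} e∈R₀ in weights-agree e∈R e≢BC

    weightSum-R : weightSum σ Δ R ≡ σ (C ∸ B) + weightSum σ Δ′ R
    weightSum-R with IsEdge⇒boundary⊎diag Δ BC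
    ... | inj₁ (inj₁ (1+B≡C , _)) = weightSum-R-sideBC 1+B≡C
    ... | inj₁ (inj₂ (B≡0 , _))   = ⊥-elim (n≮0 (subst (A <_) B≡0 A<B))
    ... | inj₂ BC∈Δ               = weightSum-R-diagBC BC∈Δ

    c-Δ : c σ Δ ≡ modℕ (2 * σ (C ∸ A) + σ (C ∸ B) + weightSum σ Δ′ R) (3 * σ n)
    c-Δ = trans (c≡weightSum Δ) (cong (λ x → modℕ x (3 * σ n)) (begin
      weightSum σ Δ (diags Δ)                               ≡⟨ weightSum-Δ ⟩
      2 * σ (C ∸ A) + weightSum σ Δ R                       ≡⟨ cong (2 * σ (C ∸ A) +_) weightSum-R ⟩
      2 * σ (C ∸ A) + (σ (C ∸ B) + weightSum σ Δ′ R)        ≡⟨ +-assoc (2 * σ (C ∸ A)) _ _ ⟨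
      2 * σ (C ∸ A) + σ (C ∸ B) + weightSum σ Δ′ R          ∎))
      where open ≡-Reasoning

    c-Δ′ : c σ Δ′ ≡ modℕ (3 * σ (D ∸ B) + weightSum σ Δ′ R) (3 * σ n)
    c-Δ′ = trans (c≡weightSum Δ′) (cong (λ x → modℕ x (3 * σ n)) weightSum-Δ′)

proposition4 : (n : ℕ) → 4 ≤ n → (r : Real) → OneLt r →
    (σ : ℕ → ℕ) → IsScale r σ →
    (T T' : Triangulation n) → (A B C D : ℕ) →
    A < B → B < C → C < D →
    (A , C) ∈ diags T →
    isEdgeᵇ T (A , B) ≡ true → isEdgeᵇ T (B , C) ≡ true →
    isEdgeᵇ T (C , D) ≡ true → isEdgeᵇ T (A , D) ≡ true →
    (∀ e → e ∈ diags T' → (e ∈ diags T × e ≢ (A , C)) ⊎ e ≡ (B , D)) →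
    (∀ e → (e ∈ diags T × e ≢ (A , C)) ⊎ e ≡ (B , D) → e ∈ diags T') →
    ExactlyTwoEqual (σ (C ∸ A)) (σ (D ∸ B)) (σ (C ∸ B)) →
    c σ T' ≢ c σ T
proposition4 n _ r _ σ σ-isScale Δ Δ′ A B C D A<B B<C C<D AC∈Δ AB BC CD AD Δ′⊆ ⊆Δ′ exactlyTwo c′≡c =
  ExactlyTwoEqual⇒3b+x≢2a+d+x-mod-3s (weightSum σ Δ′ R)
    (σ-gap-positive A<B B<C) (σ-gap-positive B<C C<D)
    (σ-chord≤σ A<C C≤n) (σ-chord≤σ B<D D≤n) (σ-chord≤σ B<C C≤n)
    exactlyTwo (trans (sym c-Δ′) (trans c′≡c c-Δ))
  where
  open Flip Δ Δ′ A<B B<C C<D AC∈Δ (from T-≡ AB) (from T-≡ BC) (from T-≡ CD) (from T-≡ AD)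
            Δ′⊆ ⊆Δ′
  open Cost {r} {σ} σ-isScale
  open Scale {r} {σ} σ-isScale
  D≤n : D ≤ n
  D≤n = <⇒≤ (IsEdge⇒<n Δ (from T-≡ CD))
  C≤n : C ≤ n
  C≤n = ≤-trans (<⇒≤ C<D) D≤n
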